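{- Let $S$ be an $\mathfrak S$-type, $Y=S'\to S''$ an $\mathfrak O$-type and $p\in\mathbb N$ a precision for $\mathbb U$. For every weakly continuous model $M:S\to Y$, every oracle $\Omega:Y$ and every continuous loss function $\Phi:Y\to Y\to\mathbb U$, one can construct a parameter $k_0\in S$ such that for all $k\in S$, $\Phi(\Omega,M_{k_0})\leqslant_p\Phi(\Omega,M_k)$.
   Context: $\mathfrak S$-types are defined inductively: every finite non-empty type is an $\mathfrak S$-type; if $S,S'$ are $\mathfrak S$-types then so is $S\times S'$; if $S$ is an $\mathfrak S$-type then so is $\mathbb N\to S$. An $\mathfrak O$-type is a type $S'\to S''$ of all functions between two $\mathfrak S$-types. The exactness type $E(S)$: $E(F)=\mathbf 1$ for finite $F$; $E(S\times S')=E(S)\times E(S')$; $E(\mathbb N\to S)=\mathbb N\times E(S)$. Equality with precision $p\in E(S)$, $x\equiv_p y$: for finite types iff $x=y$; for products componentwise; for sequences, $\alpha\equiv_{(m,p)}\beta$ iff $\alpha(i)\equiv_p\beta(i)$ for all $i<m$. $\mathbb U=\mathbb N\to\{0,1\}$ (binary sequences encoding reals in $[0,1]$); $0_{\mathbb U}$ is the all-zero sequence; $E(\mathbb U)=\mathbb N\times\mathbf 1$ is identified with $\mathbb N$, so $a\equiv_p b$ iff $a(i)=b(i)$ for all $i<p$. For $a,b\in\mathbb U$, $a<_p b$ iff there is $k<p$ with $a(i)=b(i)$ for all $i<k$ and $a(k)<b(k)$; $a\leqslant_p b$ iff $a<_p b$ or $a\equiv_p b$. For $f,g:S'\to S''$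 and $p\in E(S'')$, $f\approx_p g$ means $f(x)\equiv_p g(x)$ for all $x$. A model is a function $M:S\to Y$, written $M_k=M(k)$; it is weakly continuous if for every $p\in E(S'')$ there is $q\in E(S)$ with $k\equiv_q k'\Rightarrow M_k\approx_p M_{k'}$. A loss function is $\Phi:Y\to Y\to\mathbb U$ with $\Phi(f,f)=0_{\mathbb U}$ for all $f$; it is continuous if for every $p\in E(\mathbb U)$ there is $q\in E(S'')$ (the modulus of continuity of $\Phi$ for $p$) such that for all $g,h:Y$ with $g\approx_q h$ and all $f:Y$, $\Phi(f,g)\equiv_p\Phi(f,h)$. -}

module Defs where

open import Data.Nat using (ℕ; zero; suc; _<_)
import Data.Fin
open import Data.Fin using (Fin) renaming (_<_ to _<ᶠ_)
open import Data.Unit using (⊤; tt)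
open import Data.Product using (Σ; _×_; _,_; ∃-syntax)
open import Data.Sum using (_⊎_)
open import Relation.Binary.PropositionalEquality using (_≡_)

-- Codes for 𝔖-types.  A finite non-empty type is represented by Fin (suc n).
data SType : Set where
  fin : ℕ → SType
  _⊗_ : SType → SType → SType
  seq : SType → SType

infixr 5 _⊗_

⟦_⟧ : SType → Set
⟦ fin n ⟧ = Fin (suc n)
⟦ a ⊗ b ⟧ = ⟦ a ⟧ × ⟦ b ⟧
⟦ seq a ⟧ = ℕ → ⟦ a ⟧

OType : SType → SType → Set
OType S' S'' = ⟦ S' ⟧ → ⟦ S'' ⟧

E : SType → Set
E (fin n) = ⊤
E (a ⊗ b) = E a × E b
E (seq a) = ℕ × E a

_≡[_]_ : {S : SType} → ⟦ S ⟧ → E S → ⟦ S ⟧ → Set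
_≡[_]_ {fin n} x p y = x ≡ y
_≡[_]_ {a ⊗ b} (x , x') (p , p') (y , y') = (x ≡[ p ] y) × (x' ≡[ p' ] y')
_≡[_]_ {seq a} α (m , p) β = ∀ i → i < m → α i ≡[ p ] β i

-- 𝕌 = ℕ → {0,1}
UCode : SType
UCode = seq (fin 1)

𝕌 : Set
𝕌 = ⟦ UCode ⟧

0𝕌 : 𝕌
0𝕌 _ = Data.Fin.zero

_≡𝕌[_]_ : 𝕌 → ℕ → 𝕌 → Set
a ≡𝕌[ p ] b = _≡[_]_ {UCode} a (p , tt) b

_<𝕌[_]_ : 𝕌 → ℕ → 𝕌 → Set
a <𝕌[ p ] b = ∃[ k ] (k < p × (∀ i → i < k → a i ≡ b i) × (a k <ᶠ b k))

_≤𝕌[_]_ : 𝕌 → ℕ → 𝕌 → Set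
a ≤𝕌[ p ] b = (a <𝕌[ p ] b) ⊎ (a ≡𝕌[ p ] b)

_≈[_]_ : {S' S'' : SType} → OType S' S'' → E S'' → OType S' S'' → Set
f ≈[ p ] g = ∀ x → f x ≡[ p ] g x

WeaklyContinuous : (S S' S'' : SType) → (⟦ S ⟧ → OType S' S'') → Set
WeaklyContinuous S S' S'' M =
  (p : E S'') → Σ (E S) λ q → ∀ k k' → k ≡[ q ] k' → M k ≈[ p ] M k'

IsLoss : (S' S'' : SType) → (OType S' S'' → OType S' S'' → 𝕌) → Set
IsLoss S' S'' Φ = ∀ f (i : ℕ) → Φ f f i ≡ 0𝕌 i

ContinuousLoss : (S' S'' : SType) → (OType S' S'' → OType S' S'' → 𝕌) → Set
ContinuousLoss S' S'' Φ =
  (p : ℕ) → Σ (E S'') λ q → ∀ (g h : OType S' S'') → g ≈[ q ] h →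
    ∀ f → Φ f g ≡𝕌[ p ] Φ f h

module Submission where

open import Defs
open import Data.Nat using (ℕ; zero; suc; z<s; s<s)
open import Data.Fin as Fin using (Fin; toℕ)
open import Data.Fin.Properties as Finₚ using (toℕ<n; ≤∧≢⇒<)
open import Data.List using (List; []; _∷_; allFin; cartesianProduct; cartesianProductWith)
open import Data.List.Relation.Unary.Any as Any using (Any; here)
open import Data.List.Relation.Unary.Any.Properties using (cartesianProduct⁺; cartesianProductWith⁺)
open import Data.List.Relation.Unary.All using (lookupAny)
open import Data.List.Membership.Propositional.Properties using (∈-allFin)
import Data.List.Extrema as Extrema
open import Data.Product using (Σ; _,_; proj₁; proj₂)
open import Data.Sum using (inj₁; inj₂)
open import Data.Vec using (Vec; tabulate)
open import Data.Vec.Relation.Binary.Pointwise.Inductive using (Pointwise; tabulate⁺)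
open import Data.Vec.Relation.Binary.Lex.NonStrict as Lex using (Lex-≤; this; next)
open import Function using (_∘_)
open import Level using (0ℓ)
open import Relation.Binary.Bundles using (TotalOrder; DecTotalOrder)
open import Relation.Binary.PropositionalEquality using (_≡_; sym)

-- Weak continuity of M and continuity of Φ make k ↦ Φ(Ω, M k) uniformly
-- continuous: its first p digits only depend on k up to some precision q.
-- An 𝔖-type has a finite net at every precision q, so a minimiser over the
-- net, for the lexicographic order of the first p digits, is a global one.

digits : (p : ℕ) → 𝕌 → Vec (Fin 2) p
digits p a = tabulate (a ∘ toℕ)

lexOrder : ℕ → TotalOrder 0ℓ 0ℓ 0ℓ
lexOrder p = DecTotalOrder.totalOrder (Lex.≤-decTotalOrder (Finₚ.≤-decTotalOrder 2) p)

digits-cong : ∀ {p a b} → a ≡𝕌[ p ] b → Pointwise _≡_ (digits p a) (digits p b)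
digits-cong a≡b = tabulate⁺ (λ i → a≡b (toℕ i) (toℕ<n i))

tail : 𝕌 → 𝕌
tail a i = a (suc i)

≡𝕌-cons : ∀ {p a b} → a 0 ≡ b 0 → tail a ≡𝕌[ p ] tail b → a ≡𝕌[ suc p ] b
≡𝕌-cons a₀≡b₀ as≡bs zero    _         = a₀≡b₀
≡𝕌-cons a₀≡b₀ as≡bs (suc i) (s<s i<p) = as≡bs i i<p

<𝕌-cons : ∀ {p a b} → a 0 ≡ b 0 → tail a <𝕌[ p ] tail b → a <𝕌[ suc p ] b
<𝕌-cons a₀≡b₀ (k , k<p , as≡bs , aₖ<bₖ) = suc k , s<s k<p , ≡𝕌-cons a₀≡b₀ as≡bs , aₖ<bₖ

lex⇒≤𝕌 : ∀ p {a b} → Lex-≤ _≡_ Fin._≤_ (digits p a) (digits p b) → a ≤𝕌[ p ] b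
lex⇒≤𝕌 zero    _                          = inj₂ (λ _ ())
lex⇒≤𝕌 (suc p) (this (a₀≤b₀ , a₀≢b₀) _)    = inj₁ (0 , z<s , (λ _ ()) , ≤∧≢⇒< a₀≤b₀ a₀≢b₀)
lex⇒≤𝕌 (suc p) (next a₀≡b₀ as≤bs) with lex⇒≤𝕌 p as≤bs
... | inj₁ as<bs = inj₁ (<𝕌-cons a₀≡b₀ as<bs)
... | inj₂ as≡bs = inj₂ (≡𝕌-cons a₀≡b₀ as≡bs)

inhabitant : (S : SType) → ⟦ S ⟧
inhabitant (fin n) = Fin.zero
inhabitant (a ⊗ b) = inhabitant a , inhabitant b
inhabitant (seq a) = λ _ → inhabitant a

cons : {A : Set} → A → (ℕ → A) → ℕ → A
cons x α zero    = x
cons x α (suc i) = α i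

net : (S : SType) → E S → List ⟦ S ⟧
seqNet : (S : SType) → E S → ℕ → List (ℕ → ⟦ S ⟧)
net (fin n) _        = allFin (suc n)
net (a ⊗ b) (q , q') = cartesianProduct (net a q) (net b q')
net (seq a) (m , q)  = seqNet a q m
seqNet a q zero    = (λ _ → inhabitant a) ∷ []
seqNet a q (suc m) = cartesianProductWith cons (net a q) (seqNet a q m)

net-covers : (S : SType) (q : E S) (k : ⟦ S ⟧) → Any (λ r → _≡[_]_ {S} r q k) (net S q)
seqNet-covers : (S : SType) (q : E S) (m : ℕ) (α : ℕ → ⟦ S ⟧) →
  Any (λ β → _≡[_]_ {seq S} β (m , q) α) (seqNet S q m)
net-covers (fin n) _        k        = Any.map sym (∈-allFin k)
net-covers (a ⊗ b) (q , q') (k , k') = cartesianProduct⁺ (net-covers a q k) (net-covers b q' k')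
net-covers (seq a) (m , q)  α        = seqNet-covers a q m α
seqNet-covers a q zero    α = here (λ _ ())
seqNet-covers a q (suc m) α =
  cartesianProductWith⁺ cons cons-close (net-covers a q (α 0)) (seqNet-covers a q m (α ∘ suc))
  where
  cons-close : ∀ {x β} → _≡[_]_ {a} x q (α 0) → _≡[_]_ {seq a} β (m , q) (α ∘ suc) →
    _≡[_]_ {seq a} (cons x β) (suc m , q) α
  cons-close x≡α₀ β≡αs zero    _         = x≡α₀
  cons-close x≡α₀ β≡αs (suc i) (s<s i<m) = β≡αs i i<m

UniformlyContinuous : (S : SType) → (⟦ S ⟧ → 𝕌) → Set
UniformlyContinuous S f =
  (p : ℕ) → Σ (E S) λ q → ∀ k k' → _≡[_]_ {S} k q k' → f k ≡𝕌[ p ] f k'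

minimum-attained : (S : SType) {f : ⟦ S ⟧ → 𝕌} → UniformlyContinuous S f →
  (p : ℕ) → Σ ⟦ S ⟧ λ k₀ → ∀ k → f k₀ ≤𝕌[ p ] f k
minimum-attained S {f} f-cont p = k₀ , k₀-minimal
  where
  open TotalOrder (lexOrder p) using (≤-respʳ-≈)
  open Extrema (lexOrder p) using (argmin; f[argmin]≤f[xs])
  q = proj₁ (f-cont p)
  k₀ = argmin (digits p ∘ f) (inhabitant S) (net S q)
  k₀-minimal : ∀ k → f k₀ ≤𝕌[ p ] f k
  k₀-minimal k with lookupAny (f[argmin]≤f[xs] {f = digits p ∘ f} (inhabitant S) (net S q)) (net-covers S q k)
  ... | k₀≤r , r≡k = lex⇒≤𝕌 p (≤-respʳ-≈ (digits-cong (proj₂ (f-cont p) _ k r≡k)) k₀≤r)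

loss∘model-uniformlyContinuous : (S S' S'' : SType) {M : ⟦ S ⟧ → OType S' S''}
  {Φ : OType S' S'' → OType S' S'' → 𝕌} → WeaklyContinuous S S' S'' M →
  ContinuousLoss S' S'' Φ → (Ω : OType S' S'') → UniformlyContinuous S (λ k → Φ Ω (M k))
loss∘model-uniformlyContinuous S S' S'' {M} M-cont Φ-cont Ω p =
  proj₁ (M-cont q) , λ k k' k≡k' → proj₂ (Φ-cont p) (M k) (M k') (proj₂ (M-cont q) k k' k≡k') Ω
  where
  q = proj₁ (Φ-cont p)

mainTheorem10 : (S S' S'' : SType) (p : ℕ) (M : ⟦ S ⟧ → OType S' S'') →
    WeaklyContinuous S S' S'' M →
    (Ω : OType S' S'') (Φ : OType S' S'' → OType S' S'' → 𝕌) →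
    IsLoss S' S'' Φ → ContinuousLoss S' S'' Φ →
    Σ ⟦ S ⟧ λ k₀ → ∀ (k : ⟦ S ⟧) → Φ Ω (M k₀) ≤𝕌[ p ] Φ Ω (M k)
mainTheorem10 S S' S'' p M M-cont Ω Φ _ Φ-cont =
  minimum-attained S (loss∘model-uniformlyContinuous S S' S'' M-cont Φ-cont Ω) p
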